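{- There is a satisfiable HyperLTL sentence that is not satisfied by any $\omega$-regular set of traces.
   Context: Fix a finite set $AP$ of atomic propositions. A trace over $AP$ is a map $t:\mathbb{N}\to 2^{AP}$, i.e., an infinite word over the alphabet $2^{AP}$; a set of traces is $\omega$-regular if it is an $\omega$-regular language over $2^{AP}$. HyperLTL formulas are given by the grammar $\varphi ::= \exists \pi.\ \varphi \mid \forall \pi.\ \varphi \mid \psi$ and $\psi ::= a_\pi \mid \neg\psi \mid \psi\vee\psi \mid \mathbf{X}\psi \mid \psi\,\mathbf{U}\,\psi$, where $a\in AP$ and $\pi$ ranges over a countable set of trace variables. For a set $T$ of traces and a trace assignment $\Pi$ (a partial map from trace variables to traces), with $\Pi[j]$ denoting the assignment mapping each $\pi$ in the domain of $\Pi$ to the suffix $\Pi(\pi)(j)\Pi(\pi)(j+1)\cdots$: $(T,\Pi)\models a_\pi$ iff $a\in\Pi(\pi)(0)$; negation and disjunction are as usual; $(T,\Pi)\models\mathbf{X}\psi$ iff $(T,\Pi[1])\models\psi$; $(T,\Pi)\models\psi_1\mathbf{U}\psi_2$ iff there is $j\ge 0$ with $(T,\Pi[j])\models\psi_2$ and $(T,\Pi[j'])\models\psi_1$ for all $0\le j'<j$; $(T,\Pi)\models\exists\pi.\varphi$ iff there is $t\in T$ with $(T,\Pi[\pi\mapsto t])\models\varphi$; $(T,\Pi)\models\forall\pi.\varphi$ iff this holds for all $t\in T$. A sentence is a formula without free trace variables; $T$ satisfies (is a model of) a sentence $\varphi$ if $(T,\Pi_\emptyset)\models\varphi$ for the empty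 assignment $\Pi_\emptyset$. A sentence is satisfiable if it has a model. -}

module Defs where

open import Data.Nat using (ℕ; zero; suc; _+_; _≤_; _<_)
open import Data.Fin using (Fin)
open import Data.Fin.Subset using (Subset; _∈_)
open import Data.Product using (Σ; _×_; _,_)
open import Data.Sum using (_⊎_)
open import Relation.Nullary using (¬_)

-- Atomic propositions: AP = Fin k.  Letters of the alphabet 2^AP are
-- subsets of AP, i.e. Subset k.

Letter : ℕ → Set
Letter k = Subset k

Trace : ℕ → Set
Trace k = ℕ → Letter k

TraceSet : ℕ → Set₁
TraceSet k = Trace k → Set

record NBA (k : ℕ) : Set where
  field
    nStates   : ℕ
    initial   : Subset nStates
    δ         : Fin nStates → Letter k → Subset nStates
    accepting : Subset nStates

module _ {k : ℕ} (A : NBA k) where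
  open NBA A

  IsAcceptingRun : Trace k → (ℕ → Fin nStates) → Set
  IsAcceptingRun t ρ =
    (ρ 0 ∈ initial)
    × ((i : ℕ) → ρ (suc i) ∈ δ (ρ i) (t i))
    × ((i : ℕ) → Σ ℕ λ j → i ≤ j × ρ j ∈ accepting)

  Accepts : Trace k → Set
  Accepts t = Σ (ℕ → Fin nStates) λ ρ → IsAcceptingRun t ρ

OmegaRegular : {k : ℕ} → TraceSet k → Set
OmegaRegular {k} T =
  Σ (NBA k) λ A → (t : Trace k) → (T t → Accepts A t) × (Accepts A t → T t)

-- HyperLTL syntax, trace variables as de Bruijn indices:
-- LTL k m : quantifier-free part with m trace variables in scope,
-- HyperLTL k m : formula with m trace variables in scope.

data LTL (k m : ℕ) : Set where
  atom : Fin k → Fin m → LTL k m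
  ¬′_  : LTL k m → LTL k m
  _∨′_ : LTL k m → LTL k m → LTL k m
  X    : LTL k m → LTL k m
  _U_  : LTL k m → LTL k m → LTL k m

data HyperLTL (k m : ℕ) : Set where
  ∃π  : HyperLTL k (suc m) → HyperLTL k m
  ∀π  : HyperLTL k (suc m) → HyperLTL k m
  body : LTL k m → HyperLTL k m

Sentence : ℕ → Set
Sentence k = HyperLTL k 0

Assignment : ℕ → ℕ → Set
Assignment k m = Fin m → Trace k

shift : {k m : ℕ} → ℕ → Assignment k m → Assignment k m
shift j Π π i = Π π (j + i)

extend : {k m : ℕ} → Trace k → Assignment k m → Assignment k (suc m)
extend t Π Fin.zero    = t
extend t Π (Fin.suc π) = Π π

_⊨ₗ_ : {k m : ℕ} → Assignment k m → LTL k m → Set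
Π ⊨ₗ atom a π = a ∈ Π π 0
Π ⊨ₗ (¬′ ψ) = ¬ (Π ⊨ₗ ψ)
Π ⊨ₗ (ψ₁ ∨′ ψ₂) = (Π ⊨ₗ ψ₁) ⊎ (Π ⊨ₗ ψ₂)
Π ⊨ₗ X ψ = shift 1 Π ⊨ₗ ψ
Π ⊨ₗ (ψ₁ U ψ₂) =
  Σ ℕ λ j → (shift j Π ⊨ₗ ψ₂) × ((j′ : ℕ) → j′ < j → shift j′ Π ⊨ₗ ψ₁)

Sat : {k m : ℕ} → TraceSet k → Assignment k m → HyperLTL k m → Set
Sat T Π (∃π φ) = Σ (Trace _) λ t → T t × Sat T (extend t Π) φ
Sat T Π (∀π φ) = (t : Trace _) → T t → Sat T (extend t Π) φ
Sat T Π (body ψ) = Π ⊨ₗ ψ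

Π∅ : {k : ℕ} → Assignment k 0
Π∅ ()

_⊨_ : {k : ℕ} → TraceSet k → Sentence k → Set
T ⊨ φ = Sat T Π∅ φ

Satisfiable : {k : ℕ} → Sentence k → Set₁
Satisfiable {k} φ = Σ (TraceSet k) λ T → T ⊨ φ

-- The sentence φ a says that for every trace t of a model there is a trace whose first two
-- a-positions are those of t moved by one and by two, and that no trace of the model has its
-- first a where t has it but its second one later. The first clause makes the gap between the
-- first two a-positions unbounded in every model. In the language of a Büchi automaton with n
-- states, a trace whose gap exceeds n revisits a state inside the gap; reading that stretch
-- twice gives an accepted trace with the same first a and a longer gap, which the second
-- clause forbids. The traces with a exactly at n and 2n + 2 form a model.

module Submission where

open import Defs
open import Data.Nat using (ℕ; zero; suc; _+_; _*_; _∸_; _≤_; _<_; z≤n; s≤s)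
open import Data.Nat.Properties
open import Data.Fin using (Fin; toℕ; #_)
open import Data.Fin.Subset using (_∈_; _∉_; ⁅_⁆; ⊥)
open import Data.Fin.Subset.Properties using (x∈⁅x⁆; ∉⊥)
open import Data.Fin.Properties using (pigeonhole; toℕ<n)
open import Data.Product using (Σ; _×_; _,_; proj₁; proj₂; ∃-syntax; ∃₂)
open import Data.Sum using (_⊎_; inj₁; inj₂; [_,_])
import Data.Sum as Sum
open import Function using (_∘_; _$_; _⇔_; mk⇔; Equivalence)
open import Effect.Monad using (RawMonad)
open import Level using (0ℓ)
open import Relation.Binary.PropositionalEquality hiding ([_])
open import Relation.Binary.Definitions using (tri<; tri≈; tri>)
open import Relation.Nullary using (¬_; yes; no; does; contradiction)
open import Relation.Nullary.Decidable using (_⊎-dec_)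
open import Relation.Unary using (Decidable)
open import Data.Bool using (if_then_else_)
open import Relation.Nullary.Negation using (¬¬-Monad)

open Equivalence using (to; from)
open RawMonad (¬¬-Monad {0ℓ}) using (_>>=_; return)

variable
  k m i i′ j p q p′ q′ x : ℕ
  a : Fin k
  u v : Fin m
  t t′ : Trace k
  Π : Assignment k m
  ψ ψ₁ ψ₂ : LTL k m

infixr 6 _∧′_
_∧′_ : LTL k m → LTL k m → LTL k m
ψ₁ ∧′ ψ₂ = ¬′ ((¬′ ψ₁) ∨′ (¬′ ψ₂))

⊨ₗ-resp-≗ : ∀ (ψ : LTL k m) {Π Π′} → (∀ u x → Π u x ≡ Π′ u x) → Π ⊨ₗ ψ → Π′ ⊨ₗ ψ
⊨ₗ-resp-≗ (atom a u) eq h = subst (a ∈_) (eq u 0) h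
⊨ₗ-resp-≗ (¬′ ψ) eq h = h ∘ ⊨ₗ-resp-≗ ψ (λ u x → sym (eq u x))
⊨ₗ-resp-≗ (ψ₁ ∨′ ψ₂) eq = Sum.map (⊨ₗ-resp-≗ ψ₁ eq) (⊨ₗ-resp-≗ ψ₂ eq)
⊨ₗ-resp-≗ (X ψ) eq = ⊨ₗ-resp-≗ ψ (λ u x → eq u (1 + x))
⊨ₗ-resp-≗ (ψ₁ U ψ₂) eq (j , h₂ , h₁) =
  j , ⊨ₗ-resp-≗ ψ₂ (λ u x → eq u (j + x)) h₂
    , λ j′ j′<j → ⊨ₗ-resp-≗ ψ₁ (λ u x → eq u (j′ + x)) (h₁ j′ j′<j)

infix 4 _⊨[_]_
-- Opaque, so that the implicit arguments of the lemmas below are found by unification.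
opaque
  _⊨[_]_ : Assignment k m → ℕ → LTL k m → Set
  Π ⊨[ i ] ψ = shift i Π ⊨ₗ ψ

opaque
  unfolding _⊨[_]_

  ⊨[0]⇔⊨ₗ : Π ⊨[ 0 ] ψ ⇔ Π ⊨ₗ ψ
  ⊨[0]⇔⊨ₗ = mk⇔ (λ h → h) (λ h → h)

  shift-⊨[] : shift i Π ⊨[ j ] ψ ⇔ Π ⊨[ i + j ] ψ
  shift-⊨[] {i = i} {Π = Π} {j = j} {ψ = ψ} = mk⇔
    (⊨ₗ-resp-≗ ψ λ u x → cong (Π u) (sym (+-assoc i j x)))
    (⊨ₗ-resp-≗ ψ λ u x → cong (Π u) (+-assoc i j x))

  atom-at : Π ⊨[ i ] atom a u ⇔ a ∈ Π u i
  atom-at {Π = Π} {i = i} {a = a} {u = u} = mk⇔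
    (subst (λ x → a ∈ Π u x) (+-identityʳ i))
    (subst (λ x → a ∈ Π u x) (sym (+-identityʳ i)))

  ¬-at : Π ⊨[ i ] ¬′ ψ ⇔ (¬ Π ⊨[ i ] ψ)
  ¬-at = mk⇔ (λ h → h) (λ h → h)

  X-at : Π ⊨[ i ] X ψ ⇔ Π ⊨[ suc i ] ψ
  X-at {Π = Π} {i = i} {ψ = ψ} = mk⇔
    (⊨ₗ-resp-≗ ψ λ u x → cong (Π u) (+-suc i x))
    (⊨ₗ-resp-≗ ψ λ u x → cong (Π u) (sym (+-suc i x)))

  ∧-intro : Π ⊨[ i ] ψ₁ → Π ⊨[ i ] ψ₂ → Π ⊨[ i ] ψ₁ ∧′ ψ₂
  ∧-intro h₁ h₂ = [ (λ ¬h₁ → ¬h₁ h₁) , (λ ¬h₂ → ¬h₂ h₂) ]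

  -- As ∧′ is encoded by negations, its conjuncts are only recovered under ¬ ¬.
  ∧-elim : Π ⊨[ i ] ψ₁ ∧′ ψ₂ → ¬ ¬ (Π ⊨[ i ] ψ₁ × Π ⊨[ i ] ψ₂)
  ∧-elim h ¬both = h (inj₁ λ h₁ → h (inj₂ λ h₂ → ¬both (h₁ , h₂)))

  ¬∧¬-at : Π ⊨[ i ] ¬′ ψ₁ ∧′ ¬′ ψ₂ ⇔ (¬ Π ⊨[ i ] ψ₁ × ¬ Π ⊨[ i ] ψ₂)
  ¬∧¬-at = mk⇔
    (λ h → (λ h₁ → h (inj₁ λ ¬h₁ → ¬h₁ h₁)) , (λ h₂ → h (inj₂ λ ¬h₂ → ¬h₂ h₂)))
    (λ (¬h₁ , ¬h₂) → [ (λ ¬¬h₁ → ¬¬h₁ ¬h₁) , (λ ¬¬h₂ → ¬¬h₂ ¬h₂) ])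

  U-offset : Π ⊨[ i ] ψ₁ U ψ₂ ⇔ (∃[ d ] shift i Π ⊨[ d ] ψ₂ × (∀ d′ → d′ < d → shift i Π ⊨[ d′ ] ψ₁))
  U-offset = mk⇔ (λ h → h) (λ h → h)

U-at : Π ⊨[ i ] ψ₁ U ψ₂ ⇔ (∃[ j ] i ≤ j × Π ⊨[ j ] ψ₂ × (∀ x → i ≤ x → x < j → Π ⊨[ x ] ψ₁))
U-at {i = i} {ψ₁ = ψ₁} {ψ₂ = ψ₂} = mk⇔
  (λ h → let (d , h₂ , h₁) = to U-offset h in
    i + d , m≤m+n i d , to shift-⊨[] h₂ , λ x i≤x x<i+d →
      subst (_ ⊨[_] ψ₁) (m+[n∸m]≡n i≤x)
        (to shift-⊨[] (h₁ (x ∸ i) (subst (x ∸ i <_) (m+n∸m≡n i d) (∸-monoˡ-< x<i+d i≤x)))))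
  (λ (j , i≤j , h₂ , h₁) → from U-offset $
    j ∸ i , from shift-⊨[] (subst (_ ⊨[_] ψ₂) (sym (m+[n∸m]≡n i≤j)) h₂) , λ d d<j∸i →
      from shift-⊨[] (h₁ (i + d) (m≤m+n i d) (subst (i + d <_) (m+[n∸m]≡n i≤j) (+-monoʳ-< i d<j∸i))))

¬atom-at : Π ⊨[ i ] ¬′ atom a u ⇔ a ∉ Π u i
¬atom-at = mk⇔ (λ h → to ¬-at h ∘ from atom-at) (λ h → from ¬-at (h ∘ to atom-at))

neither-at : Π ⊨[ i ] ¬′ atom a u ∧′ ¬′ atom a v ⇔ (a ∉ Π u i × a ∉ Π v i)
neither-at = mk⇔
  (λ h → let (¬aᵘ , ¬aᵛ) = to ¬∧¬-at h in ¬aᵘ ∘ from atom-at , ¬aᵛ ∘ from atom-at)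
  (λ (¬aᵘ , ¬aᵛ) → from ¬∧¬-at (¬aᵘ ∘ to atom-at , ¬aᵛ ∘ to atom-at))

Absent : Fin k → Trace k → ℕ → ℕ → Set
Absent a t b e = ∀ x → b ≤ x → x < e → a ∉ t x

Absent-single : a ∉ t i → Absent a t i (suc i)
Absent-single {a = a} {t = t} a∉ x i≤x x<1+i = subst (λ y → a ∉ t y) (≤-antisym i≤x (≤-pred x<1+i)) a∉

Absent-++ : Absent a t i j → Absent a t j p → Absent a t i p
Absent-++ {j = j} abs₁ abs₂ x i≤x x<p with x <? j
... | yes x<j = abs₁ x i≤x x<j
... | no x≮j = abs₂ x (≮⇒≥ x≮j) x<p

Absent-shrink : i ≤ i′ → p′ ≤ p → Absent a t i p → Absent a t i′ p′
Absent-shrink i≤i′ p′≤p abs x i′≤x x<p′ = abs x (≤-trans i≤i′ i′≤x) (<-≤-trans x<p′ p′≤p)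

Absent-∈⇒≤ : Absent a t i p → a ∈ t x → i ≤ x → p ≤ x
Absent-∈⇒≤ abs a∈ i≤x = ≮⇒≥ λ x<p → abs _ i≤x x<p a∈

first-occurrence-unique : Absent a t i p → a ∈ t p → Absent a t i p′ → a ∈ t p′ →
  i ≤ p → i ≤ p′ → p ≡ p′
first-occurrence-unique abs a∈ abs′ a∈′ i≤p i≤p′ =
  ≤-antisym (Absent-∈⇒≤ abs a∈′ i≤p′) (Absent-∈⇒≤ abs′ a∈ i≤p)

record FirstTwo (a : Fin k) (t : Trace k) (p q : ℕ) : Set where
  field
    before  : Absent a t 0 p
    first   : a ∈ t p
    p<q     : p < q
    between : Absent a t (suc p) q
    second  : a ∈ t q
open FirstTwo

FirstTwo-unique : FirstTwo a t p q → FirstTwo a t p′ q′ → p ≡ p′ × q ≡ q′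
FirstTwo-unique f f′ with first-occurrence-unique (before f) (first f) (before f′) (first f′) z≤n z≤n
... | refl = refl , first-occurrence-unique (between f) (second f) (between f′) (second f′) (p<q f) (p<q f′)

BothAbsent : Fin k → Assignment k m → Fin m → Fin m → ℕ → ℕ → Set
BothAbsent a Π u v i j = Absent a (Π u) i j × Absent a (Π v) i j

NeitherUntil : Fin k → Fin m → Fin m → LTL k m → LTL k m
NeitherUntil a u v ψ = (¬′ atom a u ∧′ ¬′ atom a v) U ψ

NeitherUntil-at : Π ⊨[ i ] NeitherUntil a u v ψ ⇔ (∃[ j ] i ≤ j × Π ⊨[ j ] ψ × BothAbsent a Π u v i j)
NeitherUntil-at = mk⇔
  (λ h → let (j , i≤j , hψ , pre) = to U-at h in
    j , i≤j , hψ , (λ x i≤x x<j → proj₁ (to neither-at (pre x i≤x x<j)))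
                 , (λ x i≤x x<j → proj₂ (to neither-at (pre x i≤x x<j))))
  (λ (j , i≤j , hψ , absᵘ , absᵛ) → from U-at
    (j , i≤j , hψ , λ x i≤x x<j → from neither-at (absᵘ x i≤x x<j , absᵛ x i≤x x<j)))

Stretched : Fin k → Fin m → Fin m → LTL k m
Stretched a u v =
  NeitherUntil a u v (aᵘ ∧′ ¬ᵛ ∧′ X (aᵛ ∧′ ¬ᵘ ∧′ X (NeitherUntil a u v (aᵘ ∧′ ¬ᵛ ∧′ X (¬ᵛ ∧′ X aᵛ)))))
  where
  aᵘ aᵛ ¬ᵘ ¬ᵛ : LTL _ _
  aᵘ = atom a u
  aᵛ = atom a v
  ¬ᵘ = ¬′ aᵘ
  ¬ᵛ = ¬′ aᵛ

Stretched-sound : Π ⊨[ 0 ] Stretched a u v →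
  ¬ ¬ (∃₂ λ p q → FirstTwo a (Π u) p q × FirstTwo a (Π v) (suc p) (2 + q))
Stretched-sound h = do
  let (p , _ , h₁ , absᵘ , absᵛ) = to NeitherUntil-at h
  (aᵘp , h₂) ← ∧-elim h₁
  (¬aᵛp , h₃) ← ∧-elim h₂
  (aᵛp+1 , h₄) ← ∧-elim (to X-at h₃)
  (¬aᵘp+1 , h₅) ← ∧-elim h₄
  let (q , p+2≤q , h₆ , midᵘ , midᵛ) = to NeitherUntil-at (to X-at h₅)
  (aᵘq , h₇) ← ∧-elim h₆
  (¬aᵛq , h₈) ← ∧-elim h₇
  (¬aᵛq+1 , aᵛq+2) ← ∧-elim (to X-at h₈)
  return (p , q ,
    record
      { before  = absᵘ
      ; first   = to atom-at aᵘp
      ; p<q     = <⇒≤ p+2≤q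
      ; between = Absent-++ (Absent-single (to ¬atom-at ¬aᵘp+1)) midᵘ
      ; second  = to atom-at aᵘq
      } ,
    record
      { before  = Absent-++ absᵛ (Absent-single (to ¬atom-at ¬aᵛp))
      ; first   = to atom-at aᵛp+1
      ; p<q     = ≤-trans p+2≤q (m≤n+m q 2)
      ; between = Absent-++ midᵛ
          (Absent-++ (Absent-single (to ¬atom-at ¬aᵛq)) (Absent-single (to ¬atom-at ¬aᵛq+1)))
      ; second  = to atom-at (to X-at aᵛq+2)
      })

Stretched-complete : FirstTwo a (Π u) p q → suc p < q → FirstTwo a (Π v) (suc p) (2 + q) →
  Π ⊨[ 0 ] Stretched a u v
Stretched-complete {a = a} {Π = Π} {u = u} {p = p} {q = q} {v = v} fᵘ p+1<q fᵛ = from NeitherUntil-at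
  ( p , z≤n
  , ∧-intro (from atom-at (first fᵘ))
      (∧-intro (from ¬atom-at (before fᵛ p z≤n (n<1+n p)))
        (from X-at (∧-intro (from atom-at (first fᵛ))
          (∧-intro (from ¬atom-at (between fᵘ (suc p) ≤-refl p+1<q)) (from X-at closing)))))
  , before fᵘ
  , Absent-shrink ≤-refl (n≤1+n p) (before fᵛ) )
  where
  closing : Π ⊨[ 2 + p ] NeitherUntil a u v (atom a u ∧′ ¬′ atom a v ∧′ X (¬′ atom a v ∧′ X (atom a v)))
  closing = from NeitherUntil-at
    ( q , p+1<q
    , ∧-intro (from atom-at (second fᵘ))
        (∧-intro (from ¬atom-at (between fᵛ q p+1<q (≤-trans (n<1+n q) (n≤1+n (suc q)))))
          (from X-at (∧-intro (from ¬atom-at (between fᵛ (suc q) (≤-trans p+1<q (n≤1+n q)) (n<1+n (suc q))))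
            (from X-at (from atom-at (second fᵛ))))))
    , Absent-shrink (n≤1+n _) ≤-refl (between fᵘ)
    , Absent-shrink ≤-refl (m≤n+m q 2) (between fᵛ) )

LateSecond : Fin k → Trace k → ℕ → ℕ → Set
LateSecond a t p q = Absent a t 0 p × a ∈ t p × Absent a t (suc p) (suc q)

LongerGap : Fin k → Fin m → Fin m → LTL k m
LongerGap a u v =
  NeitherUntil a u v (atom a u ∧′ atom a v ∧′ X ((¬′ atom a v) U (atom a u ∧′ ¬′ atom a v)))

LongerGap-sound : Π ⊨[ 0 ] LongerGap a u v → FirstTwo a (Π u) p q → FirstTwo a (Π v) p′ q′ →
  ¬ ¬ (p ≡ p′ × q < q′)
LongerGap-sound {Π = Π} {a = a} {v = v} h fᵘ fᵛ = do
  let (j , _ , h₁ , absᵘ , absᵛ) = to NeitherUntil-at h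
  (aᵘj , h₂) ← ∧-elim h₁
  (aᵛj , h₃) ← ∧-elim h₂
  let (y , j<y , h₄ , midᵛ) = to U-at (to X-at h₃)
  (aᵘy , ¬aᵛy) ← ∧-elim h₄
  let j≡p  = first-occurrence-unique absᵘ (to atom-at aᵘj) (before fᵘ) (first fᵘ) z≤n z≤n
      j≡p′ = first-occurrence-unique absᵛ (to atom-at aᵛj) (before fᵛ) (first fᵛ) z≤n z≤n
      absᵛ′ : Absent a (Π v) (suc j) (suc y)
      absᵛ′ = Absent-++ (λ x j<x x<y → to ¬atom-at (midᵛ x j<x x<y)) (Absent-single (to ¬atom-at ¬aᵛy))
  return ( trans (sym j≡p) j≡p′
         , <-≤-trans (s≤s (Absent-∈⇒≤ (between fᵘ) (to atom-at aᵘy) (subst (_< y) j≡p j<y)))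
                     (Absent-∈⇒≤ absᵛ′ (second fᵛ) (subst (_< _) (sym j≡p′) (p<q fᵛ))) )

LongerGap-complete : FirstTwo a (Π u) p q → LateSecond a (Π v) p q → Π ⊨[ 0 ] LongerGap a u v
LongerGap-complete {p = p} {q = q} fᵘ (beforeᵛ , firstᵛ , absᵛ) = from NeitherUntil-at
  ( p , z≤n
  , ∧-intro (from atom-at (first fᵘ))
      (∧-intro (from atom-at firstᵛ)
        (from X-at (from U-at
          ( q , p<q fᵘ
          , ∧-intro (from atom-at (second fᵘ)) (from ¬atom-at (absᵛ q (p<q fᵘ) (n<1+n q)))
          , λ x p<x x<q → from ¬atom-at (absᵛ x p<x (<-trans x<q (n<1+n q)))))))
  , before fᵘ , beforeᵛ )

π₁ π₂ π₃ : Fin 4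
π₁ = # 2
π₂ = # 1
π₃ = # 0

⟪_,_,_,_⟫ : Trace k → Trace k → Trace k → Trace k → Assignment k 4
⟪ t₀ , t₁ , t₂ , t₃ ⟫ = extend t₃ (extend t₂ (extend t₁ (extend t₀ Π∅)))

Body : Fin k → LTL k 4
Body a = Stretched a π₁ π₃ ∧′ ¬′ LongerGap a π₁ π₂

-- ∃π₀ ∀π₁ ∀π₂ ∃π₃ Body, with de Bruijn indices; π₀ only makes models nonempty.
φ : Fin k → Sentence k
φ a = ∃π (∀π (∀π (∃π (body (Body a)))))

mark : {P : ℕ → Set} → Fin k → Decidable P → Trace k
mark a P? x = if does (P? x) then ⁅ a ⁆ else ⊥

mark-∈ : {P : ℕ → Set} (P? : Decidable P) → P x → a ∈ mark a P? x
mark-∈ {x = x} {a = a} P? Px with P? x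
... | yes _ = x∈⁅x⁆ a
... | no ¬Px = contradiction Px ¬Px

mark-∉ : {P : ℕ → Set} (P? : Decidable P) → ¬ P x → a ∉ mark a P? x
mark-∉ {x = x} P? ¬Px with P? x
... | yes Px = contradiction Px ¬Px
... | no _ = ∉⊥

twoMarks : Fin k → ℕ → ℕ → Trace k
twoMarks a p q = mark a (λ x → (x ≟ p) ⊎-dec (x ≟ q))

twoMarks-FirstTwo : p < q → FirstTwo a (twoMarks a p q) p q
twoMarks-FirstTwo {p = p} {q = q} {a = a} p<q = record
  { before  = λ x _ x<p → off [ <⇒≢ x<p , <⇒≢ (<-trans x<p p<q) ]
  ; first   = on (inj₁ refl)
  ; p<q     = p<q
  ; between = λ x p<x x<q → off [ >⇒≢ p<x , <⇒≢ x<q ]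
  ; second  = on (inj₂ refl)
  }
  where
  on : x ≡ p ⊎ x ≡ q → a ∈ twoMarks a p q x
  on = mark-∈ (λ x → (x ≟ p) ⊎-dec (x ≟ q))
  off : ¬ (x ≡ p ⊎ x ≡ q) → a ∉ twoMarks a p q x
  off = mark-∉ (λ x → (x ≟ p) ⊎-dec (x ≟ q))

gapTrace : Fin k → ℕ → Trace k
gapTrace a n = twoMarks a n (2 + n * 2)

gapTrace-FirstTwo : ∀ n → FirstTwo a (gapTrace a n) n (2 + n * 2)
gapTrace-FirstTwo n = twoMarks-FirstTwo (≤-trans (n<1+n n) (s≤s (≤-trans (m≤m*n n 2) (n≤1+n _))))

GapModel : Fin k → TraceSet k
GapModel a t = ∃[ n ] t ≡ gapTrace a n

GapModel-⊨φ : GapModel a ⊨ φ a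
GapModel-⊨φ {a = a} = gapTrace a 0 , (0 , refl) , λ { _ (n , refl) _ (n′ , refl) →
  gapTrace a (suc n) , (suc n , refl) ,
  to (⊨[0]⇔⊨ₗ {Π = ⟪ gapTrace a 0 , gapTrace a n , gapTrace a n′ , gapTrace a (suc n) ⟫} {ψ = Body a})
    (∧-intro (Stretched-complete (gapTrace-FirstTwo n) (s≤s (s≤s (m≤m*n n 2))) (gapTrace-FirstTwo (suc n)))
             (from ¬-at λ hL → LongerGap-sound hL (gapTrace-FirstTwo n) (gapTrace-FirstTwo n′)
                                 λ (n≡n′ , q<q′) → <-irrefl (cong (λ n → 2 + n * 2) n≡n′) q<q′)) }

-- t ∘ replay i d is t with the block [i, i + d) read twice.
replay : ℕ → ℕ → ℕ → ℕ
replay i d x with x <? i + d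
... | yes _ = x
... | no  _ = x ∸ d

replay-< : ∀ i d {x} → x < i + d → replay i d x ≡ x
replay-< i d {x} x<i+d with x <? i + d
... | yes _ = refl
... | no x≮i+d = contradiction x<i+d x≮i+d

replay-≥ : ∀ i d {x} → i + d ≤ x → replay i d x ≡ x ∸ d
replay-≥ i d {x} i+d≤x with x <? i + d
... | yes x<i+d = contradiction i+d≤x (<⇒≱ x<i+d)
... | no _ = refl

replay-zero : ∀ i d → replay i d 0 ≡ 0
replay-zero i d with 0 <? i + d
... | yes _ = refl
... | no _ = 0∸n≡0 d

replay-+ : ∀ i d {y} → i ≤ y → replay i d (y + d) ≡ y
replay-+ i d {y} i≤y = trans (replay-≥ i d (+-monoˡ-≤ d i≤y)) (m+n∸n≡m y d)

replay-suc : ∀ {A : Set} (f : ℕ → A) {i d} → f i ≡ f (i + d) →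
  ∀ x → f (replay i d (suc x)) ≡ f (suc (replay i d x))
replay-suc f {i} {d} fi≡fi+d x with <-cmp (suc x) (i + d)
... | tri< x+1<i+d _ _ =
  cong f (trans (replay-< i d x+1<i+d) (cong suc (sym (replay-< i d (<-trans (n<1+n x) x+1<i+d)))))
... | tri≈ _ x+1≡i+d _ = begin
  f (replay i d (suc x))  ≡⟨ cong f (replay-≥ i d (≤-reflexive (sym x+1≡i+d))) ⟩
  f (suc x ∸ d)           ≡⟨ cong (λ y → f (y ∸ d)) x+1≡i+d ⟩
  f (i + d ∸ d)           ≡⟨ cong f (m+n∸n≡m i d) ⟩
  f i                     ≡⟨ fi≡fi+d ⟩
  f (i + d)               ≡⟨ cong f (sym x+1≡i+d) ⟩
  f (suc x)               ≡⟨ cong (f ∘ suc) (sym (replay-< i d (≤-reflexive x+1≡i+d))) ⟩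
  f (suc (replay i d x))  ∎
  where open ≡-Reasoning
... | tri> _ _ i+d<x+1 = cong f (begin
  replay i d (suc x)  ≡⟨ replay-≥ i d (<⇒≤ i+d<x+1) ⟩
  suc x ∸ d           ≡⟨ +-∸-assoc 1 (≤-trans (m≤n+m d i) (≤-pred i+d<x+1)) ⟩
  suc (x ∸ d)         ≡⟨ cong suc (sym (replay-≥ i d (≤-pred i+d<x+1))) ⟩
  suc (replay i d x)  ∎)
  where open ≡-Reasoning

replay-Absent : ∀ {b e i d} → Absent a t b e → b ≤ i → i + d ≤ e → Absent a (t ∘ replay i d) b (e + d)
replay-Absent {a = a} {t = t} {b} {e} {i} {d} abs b≤i i+d≤e x b≤x x<e+d with ≤-<-connex (i + d) x
... | inj₂ x<i+d = subst (λ y → a ∉ t y) (sym (replay-< i d x<i+d)) (abs x b≤x (<-≤-trans x<i+d i+d≤e))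
... | inj₁ i+d≤x = subst (λ y → a ∉ t y) (sym (replay-≥ i d i+d≤x))
        (abs (x ∸ d) (≤-trans b≤i (m+n≤o⇒m≤o∸n i i+d≤x))
          (subst (x ∸ d <_) (m+n∸n≡m e d) (∸-monoˡ-< x<e+d (m+n≤o⇒n≤o i i+d≤x))))

window-repeat : ∀ {n} (f : ℕ → Fin n) b → ∃₂ λ i d → b ≤ i × 0 < d × i + d ≤ b + n × f i ≡ f (i + d)
window-repeat {n} f b with pigeonhole (n<1+n n) (λ c → f (b + toℕ c))
... | c₁ , c₂ , c₁<c₂ , fc₁≡fc₂ =
  b + toℕ c₁ , toℕ c₂ ∸ toℕ c₁ , m≤m+n b (toℕ c₁) , m<n⇒0<n∸m c₁<c₂
  , ≤-trans (≤-reflexive end) (+-monoʳ-≤ b (≤-pred (toℕ<n c₂)))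
  , trans fc₁≡fc₂ (cong f (sym end))
  where
  end : b + toℕ c₁ + (toℕ c₂ ∸ toℕ c₁) ≡ b + toℕ c₂
  end = trans (+-assoc b _ _) (cong (b +_) (m+[n∸m]≡n (<⇒≤ c₁<c₂)))

module _ (A : NBA k) where
  open NBA A

  replay-run : ∀ {t ρ i d} → ρ i ≡ ρ (i + d) → IsAcceptingRun A t ρ →
    IsAcceptingRun A (t ∘ replay i d) (ρ ∘ replay i d)
  replay-run {t} {ρ} {i} {d} loop (ρ₀∈initial , steps , recurrent) =
      subst (λ x → ρ x ∈ initial) (sym (replay-zero i d)) ρ₀∈initial
    , (λ x → subst (_∈ δ (ρ (replay i d x)) (t (replay i d x)))
                   (sym (replay-suc ρ loop x)) (steps (replay i d x)))
    , λ n → let (y , n+i≤y , ρy∈accepting) = recurrent (n + i) in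
        y + d , ≤-trans (m+n≤o⇒m≤o n n+i≤y) (m≤m+n y d)
        , subst (λ x → ρ x ∈ accepting) (sym (replay-+ i d (m+n≤o⇒n≤o n n+i≤y))) ρy∈accepting

  pump-Absent : Accepts A t → ∀ {b e} → Absent a t b e → b + nStates ≤ e →
    ∃[ t′ ] Accepts A t′ × (∀ x → x < b → t′ x ≡ t x) × Absent a t′ b (suc e)
  pump-Absent {t = t} (ρ , run) {b} {e} abs b+n≤e with window-repeat ρ b
  ... | i , d , b≤i , 0<d , i+d≤b+n , loop =
    t ∘ replay i d , (ρ ∘ replay i d , replay-run loop run)
    , (λ x x<b → cong t (replay-< i d (<-≤-trans x<b (≤-trans b≤i (m≤m+n i d)))))
    , Absent-shrink ≤-refl (m<m+n e 0<d) (replay-Absent abs b≤i (≤-trans i+d≤b+n b+n≤e))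

  pump-LateSecond : Accepts A t → FirstTwo a t p q → p + nStates < q →
    ∃[ t′ ] Accepts A t′ × LateSecond a t′ p q
  pump-LateSecond {t = t} {a = a} {p = p} acc f p+n<q =
    let (t′ , acc′ , t′≗t , abs) = pump-Absent acc (between f) p+n<q in
    t′ , acc′
    , (λ x _ x<p → subst (a ∉_) (sym (t′≗t x (<-trans x<p (n<1+n p)))) (before f x z≤n x<p))
    , subst (a ∈_) (sym (t′≗t p (n<1+n p))) (first f)
    , abs

Stretches : Fin k → Trace k → Trace k → Set
Stretches a t t′ = ∃₂ λ p q → FirstTwo a t p q × FirstTwo a t′ (suc p) (2 + q)

LongGap : Fin k → ℕ → Trace k → Set
LongGap a N t = ∃₂ λ p q → FirstTwo a t p q × p + N < q

LongGap-stretch : ∀ {N} → Stretches a t t′ → LongGap a N t → LongGap a (suc N) t′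
LongGap-stretch {N = N} (p , q , f , f′) (p₀ , q₀ , f₀ , p₀+N<q₀) with FirstTwo-unique f₀ f
... | refl , refl = suc p , 2 + q , f′ , s≤s (subst (_< suc q) (sym (+-suc p N)) (s≤s p₀+N<q₀))

module _ {T : TraceSet k} (sat : T ⊨ φ a) where

  model-body : T t → T t′ →
    ∃[ t″ ] T t″ × ⟪ proj₁ sat , t , t′ , t″ ⟫ ⊨[ 0 ] Body a
  model-body t∈T t′∈T = let (t″ , t″∈T , hbody) = proj₂ (proj₂ sat) _ t∈T _ t′∈T in
    t″ , t″∈T , from ⊨[0]⇔⊨ₗ hbody

  model-stretches : T t → ¬ ¬ (∃[ t′ ] T t′ × Stretches a t t′)
  model-stretches t∈T = do
    let (t′ , t′∈T , hbody) = model-body t∈T t∈T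
    (hS , _) ← ∧-elim hbody
    st ← Stretched-sound hS
    return (t′ , t′∈T , st)

  model-no-LateSecond : T t → T t′ → FirstTwo a t p q → ¬ LateSecond a t′ p q
  model-no-LateSecond t∈T t′∈T f late =
    let (_ , _ , hbody) = model-body t∈T t′∈T in
    ∧-elim hbody λ (_ , h¬L) → to ¬-at h¬L (LongerGap-complete f late)

  model-long-gaps : ∀ N → ¬ ¬ (∃[ t ] T t × LongGap a N t)
  model-long-gaps zero = do
    let (t₀ , t₀∈T , _) = sat
    (_ , _ , p , q , f , _) ← model-stretches t₀∈T
    return (t₀ , t₀∈T , p , q , f , subst (_< q) (sym (+-identityʳ p)) (p<q f))
  model-long-gaps (suc N) = do
    (t , t∈T , long) ← model-long-gaps N
    (t′ , t′∈T , st) ← model-stretches t∈T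
    return (t′ , t′∈T , LongGap-stretch st long)

no-ω-regular-model : {T : TraceSet k} → OmegaRegular T → ¬ T ⊨ φ a
no-ω-regular-model (A , lang) sat =
  model-long-gaps sat (NBA.nStates A) λ (t , t∈T , p , q , f , p+n<q) →
    let (t′ , acc′ , late) = pump-LateSecond A (proj₁ (lang t) t∈T) f p+n<q in
    model-no-LateSecond sat t∈T (proj₂ (lang t′) acc′) f late

theorem3 : (n : ℕ) →
    Σ (Sentence (suc n)) λ φ →
    Satisfiable φ × ((T : TraceSet (suc n)) → OmegaRegular T → ¬ (T ⊨ φ))
theorem3 n = φ (# 0) , (GapModel (# 0) , GapModel-⊨φ) , λ T → no-ω-regular-model
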